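{- If $A$ is a bounded Wajsberg pseudo-hoop, then every Boolean filter of $A$ is an involutive filter of $A$.
   Context: A pseudo-hoop is an algebra $(A,\odot,\rightarrow,\rightsquigarrow,1)$ of type $(2,2,2,0)$ such that for all $x,y,z\in A$: $x\odot 1=1\odot x=x$; $x\rightarrow x=x\rightsquigarrow x=1$; $(x\odot y)\rightarrow z=x\rightarrow(y\rightarrow z)$; $(x\odot y)\rightsquigarrow z=y\rightsquigarrow(x\rightsquigarrow z)$; $(x\rightarrow y)\odot x=(y\rightarrow x)\odot y=x\odot(x\rightsquigarrow y)=y\odot(y\rightsquigarrow x)$. The order is $x\le y$ iff $x\rightarrow y=1$. It is bounded if it has a least element $0$; then $x^-=x\rightarrow 0$, $x^\sim=x\rightsquigarrow 0$, $x^{ -\sim}=(x^-)^\sim$, $x^{\sim- }=(x^\sim)^-$. Put $x\vee_1 y=(x\rightarrow y)\rightsquigarrow y$, $x\vee_2 y=(x\rightsquigarrow y)\rightarrow y$; $A$ is Wajsberg if $x\vee_1 y=y\vee_1 x$ and $x\vee_2 y=y\vee_2 x$ for all $x,y$; then $(A,\le)$ is a lattice with join $x\vee y=x\vee_1 y=x\vee_2 y$. A filter is a nonempty $F\subseteq A$ closed under $\odot$ and upward closed; it is involutive if $x^{ -\sim}\rightarrow x\in F$ and $x^{\sim- }\rightsquigarrow x\in F$ for all $x$. For a bounded Wajsberg pseudo-hoop, a filter $F$ is Boolean if $x\vee x^{ - }\in F$ and $x\vee x^{\sim}\in F$ for all $x\in A$. -}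

module Defs where

open import Level using (Level; suc; _⊔_)
open import Relation.Binary.PropositionalEquality using (_≡_)
open import Data.Product using (_×_; ∃)

record PseudoHoop (a : Level) : Set (suc a) where
  infixl 7 _⊙_
  infixr 5 _⇒_ _⇝_
  field
    Carrier : Set a
    _⊙_ : Carrier → Carrier → Carrier
    _⇒_ : Carrier → Carrier → Carrier
    _⇝_ : Carrier → Carrier → Carrier
    𝟏   : Carrier
    ⊙-identityʳ : ∀ x → x ⊙ 𝟏 ≡ x
    ⊙-identityˡ : ∀ x → 𝟏 ⊙ x ≡ x
    ⇒-refl : ∀ x → x ⇒ x ≡ 𝟏
    ⇝-refl : ∀ x → x ⇝ x ≡ 𝟏
    ⇒-curry : ∀ x y z → (x ⊙ y) ⇒ z ≡ x ⇒ (y ⇒ z)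
    ⇝-curry : ∀ x y z → (x ⊙ y) ⇝ z ≡ y ⇝ (x ⇝ z)
    divisible₁ : ∀ x y → (x ⇒ y) ⊙ x ≡ (y ⇒ x) ⊙ y
    divisible₂ : ∀ x y → (y ⇒ x) ⊙ y ≡ x ⊙ (x ⇝ y)
    divisible₃ : ∀ x y → x ⊙ (x ⇝ y) ≡ y ⊙ (y ⇝ x)

  _≤_ : Carrier → Carrier → Set a
  x ≤ y = (x ⇒ y) ≡ 𝟏

  _∨₁_ : Carrier → Carrier → Carrier
  x ∨₁ y = (x ⇒ y) ⇝ y

  _∨₂_ : Carrier → Carrier → Carrier
  x ∨₂ y = (x ⇝ y) ⇒ y

  IsWajsberg : Set a
  IsWajsberg = (∀ x y → x ∨₁ y ≡ y ∨₁ x) × (∀ x y → x ∨₂ y ≡ y ∨₂ x)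

  record IsFilter {ℓ : Level} (F : Carrier → Set ℓ) : Set (a ⊔ ℓ) where
    field
      nonempty : ∃ F
      ⊙-closed : ∀ {x y} → F x → F y → F (x ⊙ y)
      up-closed : ∀ {x y} → F x → x ≤ y → F y

record BoundedPseudoHoop (a : Level) : Set (suc a) where
  field
    hoop : PseudoHoop a
  open PseudoHoop hoop public
  field
    𝟎 : Carrier
    𝟎-least : ∀ x → 𝟎 ≤ x

  _⁻ : Carrier → Carrier
  x ⁻ = x ⇒ 𝟎

  _˜ : Carrier → Carrier
  x ˜ = x ⇝ 𝟎

  IsInvolutiveFilter : {ℓ : Level} → (Carrier → Set ℓ) → Set (a ⊔ ℓ)
  IsInvolutiveFilter F =
    IsFilter F × (∀ x → F (((x ⁻) ˜) ⇒ x)) × (∀ x → F (((x ˜) ⁻) ⇝ x))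

  -- Boolean filter (for Wajsberg A, where the join is x ∨ y = x ∨₁ y = x ∨₂ y)
  IsBooleanFilter : {ℓ : Level} → (Carrier → Set ℓ) → Set (a ⊔ ℓ)
  IsBooleanFilter F =
    IsFilter F × (∀ x → F (x ∨₁ (x ⁻))) × (∀ x → F (x ∨₁ (x ˜)))

-- In a Wajsberg pseudo-hoop x ∨₁ y is the least upper bound of x and y. Both x and
-- x⁻ lie below x⁻˜ ⇒ x (the first trivially, the second because x⁻ ⊙ x⁻˜ ≤ 0 ≤ x), so
-- x ∨₁ x⁻ ≤ x⁻˜ ⇒ x, and a filter containing x ∨₁ x⁻ contains x⁻˜ ⇒ x. The same
-- argument with ⇒ and ⇝ exchanged handles x˜⁻ ⇝ x.
module Submission where

open import Defs
open import Level using (Level)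
open import Data.Product using (_,_; proj₁)
open import Relation.Binary.PropositionalEquality
open ≡-Reasoning

module PseudoHoopProperties {a : Level} (H : PseudoHoop a) where
  open PseudoHoop H

  ≤-refl : ∀ x → x ≤ x
  ≤-refl = ⇒-refl

  ≤-factor : ∀ {x y} → x ≤ y → x ≡ (y ⇒ x) ⊙ y
  ≤-factor {x} {y} x≤y = begin
    x            ≡⟨ sym (⊙-identityˡ x) ⟩
    𝟏 ⊙ x        ≡⟨ cong (_⊙ x) (sym x≤y) ⟩
    (x ⇒ y) ⊙ x  ≡⟨ divisible₁ x y ⟩
    (y ⇒ x) ⊙ y  ∎

  ≤-antisym : ∀ {x y} → x ≤ y → y ≤ x → x ≡ y
  ≤-antisym {x} {y} x≤y y≤x = begin
    x            ≡⟨ ≤-factor x≤y ⟩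
    (y ⇒ x) ⊙ y  ≡⟨ cong (_⊙ y) y≤x ⟩
    𝟏 ⊙ y        ≡⟨ ⊙-identityˡ y ⟩
    y            ∎

  ⇒-curry-≤ : ∀ {x y z} → (x ⊙ y) ≤ z → x ≤ (y ⇒ z)
  ⇒-curry-≤ {x} {y} {z} = trans (sym (⇒-curry x y z))

  ⇒-uncurry-≤ : ∀ {x y z} → x ≤ (y ⇒ z) → (x ⊙ y) ≤ z
  ⇒-uncurry-≤ {x} {y} {z} = trans (⇒-curry x y z)

  ⇒-identityˡ : ∀ x → 𝟏 ⇒ x ≡ x
  ⇒-identityˡ x = ≤-antisym
    (subst (_≤ x) (⊙-identityʳ (𝟏 ⇒ x)) (⇒-uncurry-≤ (≤-refl (𝟏 ⇒ x))))
    (⇒-curry-≤ (subst (_≤ x) (sym (⊙-identityʳ x)) (≤-refl x)))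

  ⇒-zeroʳ : ∀ x → x ⇒ 𝟏 ≡ 𝟏
  ⇒-zeroʳ x = begin
    x ⇒ 𝟏                  ≡⟨ cong (_⇒ 𝟏) (sym ⇒𝟏⊙x≡x) ⟩
    ((x ⇒ 𝟏) ⊙ x) ⇒ 𝟏      ≡⟨ ⇒-curry (x ⇒ 𝟏) x 𝟏 ⟩
    (x ⇒ 𝟏) ⇒ (x ⇒ 𝟏)      ≡⟨ ⇒-refl (x ⇒ 𝟏) ⟩
    𝟏                      ∎
    where
    ⇒𝟏⊙x≡x : (x ⇒ 𝟏) ⊙ x ≡ x
    ⇒𝟏⊙x≡x = trans (divisible₁ x 𝟏) (trans (⊙-identityʳ (𝟏 ⇒ x)) (⇒-identityˡ x))

  ⇝-identityˡ : ∀ x → 𝟏 ⇝ x ≡ x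
  ⇝-identityˡ x = begin
    𝟏 ⇝ x            ≡⟨ sym (⊙-identityˡ (𝟏 ⇝ x)) ⟩
    𝟏 ⊙ (𝟏 ⇝ x)      ≡⟨ sym (divisible₂ 𝟏 x) ⟩
    (x ⇒ 𝟏) ⊙ x      ≡⟨ cong (_⊙ x) (⇒-zeroʳ x) ⟩
    𝟏 ⊙ x            ≡⟨ ⊙-identityˡ x ⟩
    x                ∎

  ≤→⇝≡𝟏 : ∀ {x y} → x ≤ y → x ⇝ y ≡ 𝟏
  ≤→⇝≡𝟏 {x} {y} x≤y = begin
    x ⇝ y                  ≡⟨ cong (_⇝ y) x≡x⊙⇝ ⟩
    (x ⊙ (x ⇝ y)) ⇝ y      ≡⟨ ⇝-curry x (x ⇝ y) y ⟩
    (x ⇝ y) ⇝ (x ⇝ y)      ≡⟨ ⇝-refl (x ⇝ y) ⟩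
    𝟏                      ∎
    where
    x≡x⊙⇝ : x ≡ x ⊙ (x ⇝ y)
    x≡x⊙⇝ = trans (≤-factor x≤y) (divisible₂ x y)

  ⇝≡𝟏→≤ : ∀ {x y} → x ⇝ y ≡ 𝟏 → x ≤ y
  ⇝≡𝟏→≤ {x} {y} x⇝y≡𝟏 = begin
    x ⇒ y                  ≡⟨ cong (_⇒ y) x≡⇒⊙x ⟩
    ((x ⇒ y) ⊙ x) ⇒ y      ≡⟨ ⇒-curry (x ⇒ y) x y ⟩
    (x ⇒ y) ⇒ (x ⇒ y)      ≡⟨ ⇒-refl (x ⇒ y) ⟩
    𝟏                      ∎
    where
    x≡⇒⊙x : x ≡ (x ⇒ y) ⊙ x
    x≡⇒⊙x = begin
      x                ≡⟨ sym (⊙-identityʳ x) ⟩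
      x ⊙ 𝟏            ≡⟨ cong (x ⊙_) (sym x⇝y≡𝟏) ⟩
      x ⊙ (x ⇝ y)      ≡⟨ sym (trans (divisible₁ x y) (divisible₂ x y)) ⟩
      (x ⇒ y) ⊙ x      ∎

  ⇝-curry-≤ : ∀ {x y z} → (x ⊙ y) ≤ z → y ≤ (x ⇝ z)
  ⇝-curry-≤ {x} {y} {z} x⊙y≤z = ⇝≡𝟏→≤ (trans (sym (⇝-curry x y z)) (≤→⇝≡𝟏 x⊙y≤z))

  ⇝-uncurry-≤ : ∀ {x y z} → y ≤ (x ⇝ z) → (x ⊙ y) ≤ z
  ⇝-uncurry-≤ {x} {y} {z} y≤x⇝z = ⇝≡𝟏→≤ (trans (⇝-curry x y z) (≤→⇝≡𝟏 y≤x⇝z))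

  ≤-trans : ∀ {x y z} → x ≤ y → y ≤ z → x ≤ z
  ≤-trans {x} {y} {z} x≤y y≤z = begin
    x ⇒ z                    ≡⟨ cong (_⇒ z) (≤-factor x≤y) ⟩
    ((y ⇒ x) ⊙ y) ⇒ z        ≡⟨ ⇒-curry (y ⇒ x) y z ⟩
    (y ⇒ x) ⇒ (y ⇒ z)        ≡⟨ cong ((y ⇒ x) ⇒_) y≤z ⟩
    (y ⇒ x) ⇒ 𝟏              ≡⟨ ⇒-zeroʳ (y ⇒ x) ⟩
    𝟏                        ∎

  ⇒-counit : ∀ x y → ((x ⇒ y) ⊙ x) ≤ y
  ⇒-counit x y = ⇒-uncurry-≤ (≤-refl (x ⇒ y))

  ⇝-counit : ∀ x y → (x ⊙ (x ⇝ y)) ≤ y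
  ⇝-counit x y = ⇝-uncurry-≤ (≤-refl (x ⇝ y))

  ⊙-monoʳ-≤ : ∀ x {y z} → y ≤ z → (x ⊙ y) ≤ (x ⊙ z)
  ⊙-monoʳ-≤ x {y} {z} y≤z = ⇝-uncurry-≤ (≤-trans y≤z (⇝-curry-≤ (≤-refl (x ⊙ z))))

  ⊙-monoˡ-≤ : ∀ x {y z} → y ≤ z → (y ⊙ x) ≤ (z ⊙ x)
  ⊙-monoˡ-≤ x {y} {z} y≤z = ⇒-uncurry-≤ (≤-trans y≤z (⇒-curry-≤ (≤-refl (z ⊙ x))))

  ⇒-weaken : ∀ x y → x ≤ (y ⇒ x)
  ⇒-weaken x y =
    ⇒-curry-≤ (subst ((x ⊙ y) ≤_) (⊙-identityʳ x) (⊙-monoʳ-≤ x (⇒-zeroʳ y)))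

  ⇝-weaken : ∀ x y → x ≤ (y ⇝ x)
  ⇝-weaken x y =
    ⇝-curry-≤ (subst ((y ⊙ x) ≤_) (⊙-identityˡ x) (⊙-monoˡ-≤ x (⇒-zeroʳ y)))

  ⇒-antitoneˡ : ∀ {x y} z → x ≤ y → (y ⇒ z) ≤ (x ⇒ z)
  ⇒-antitoneˡ z x≤y = ⇒-curry-≤ (≤-trans (⊙-monoʳ-≤ _ x≤y) (⇒-counit _ z))

  ⇝-antitoneˡ : ∀ {x y} z → x ≤ y → (y ⇝ z) ≤ (x ⇝ z)
  ⇝-antitoneˡ z x≤y = ⇝-curry-≤ (≤-trans (⊙-monoˡ-≤ _ x≤y) (⇝-counit _ z))

  ∨₁-least : IsWajsberg → ∀ {x y z} → x ≤ z → y ≤ z → (x ∨₁ y) ≤ z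
  ∨₁-least wajsberg {x} {y} {z} x≤z y≤z =
    subst ((x ∨₁ y) ≤_) z∨₁y≡z (⇝-antitoneˡ y (⇒-antitoneˡ y x≤z))
    where
    z∨₁y≡z : z ∨₁ y ≡ z
    z∨₁y≡z = begin
      z ∨₁ y         ≡⟨ proj₁ wajsberg z y ⟩
      (y ⇒ z) ⇝ z    ≡⟨ cong (_⇝ z) y≤z ⟩
      𝟏 ⇝ z          ≡⟨ ⇝-identityˡ z ⟩
      z              ∎

module BoundedPseudoHoopProperties {a : Level} (A : BoundedPseudoHoop a) where
  open BoundedPseudoHoop A
  open PseudoHoopProperties hoop

  ⁻≤⁻˜⇒ : ∀ x → (x ⁻) ≤ (((x ⁻) ˜) ⇒ x)
  ⁻≤⁻˜⇒ x = ⇒-curry-≤ (≤-trans (⇝-counit (x ⁻) 𝟎) (𝟎-least x))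

  ˜≤˜⁻⇝ : ∀ x → (x ˜) ≤ (((x ˜) ⁻) ⇝ x)
  ˜≤˜⁻⇝ x = ⇝-curry-≤ (≤-trans (⇒-counit (x ˜) 𝟎) (𝟎-least x))

  module _ (wajsberg : IsWajsberg) where

    ∨⁻≤⁻˜⇒ : ∀ x → (x ∨₁ (x ⁻)) ≤ (((x ⁻) ˜) ⇒ x)
    ∨⁻≤⁻˜⇒ x = ∨₁-least wajsberg (⇒-weaken x ((x ⁻) ˜)) (⁻≤⁻˜⇒ x)

    ∨˜≤˜⁻⇝ : ∀ x → (x ∨₁ (x ˜)) ≤ (((x ˜) ⁻) ⇝ x)
    ∨˜≤˜⁻⇝ x = ∨₁-least wajsberg (⇝-weaken x ((x ˜) ⁻)) (˜≤˜⁻⇝ x)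

proposition4p26 : {a ℓ : Level} (A : BoundedPseudoHoop a) → BoundedPseudoHoop.IsWajsberg A → (F : BoundedPseudoHoop.Carrier A → Set ℓ) → BoundedPseudoHoop.IsBooleanFilter A F → BoundedPseudoHoop.IsInvolutiveFilter A F
proposition4p26 A wajsberg F (isFilter , boolean⁻ , boolean˜) =
    isFilter
  , (λ x → up-closed (boolean⁻ x) (∨⁻≤⁻˜⇒ wajsberg x))
  , (λ x → up-closed (boolean˜ x) (∨˜≤˜⁻⇝ wajsberg x))
  where
  open BoundedPseudoHoop A using (module IsFilter)
  open IsFilter isFilter using (up-closed)
  open BoundedPseudoHoopProperties A
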